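{- There is a decoder $D:\{0,1\}^*\times\{0,1\}^*\to\{0,1\}$ and an absolute constant $C$ such that the following holds. Let $n\ge 2$, $d\ge 1$, $h\ge 1$ be integers and let $G$ be an $n$-vertex graph that has a signed tree model $(T,A(T),B(T))$ of width $d$ in which $T$ has depth $h$. Then one can assign to every vertex $v$ of $G$ a binary string $\ell(v)$ of length at most $C\, d\, h \log n$ such that for all distinct $u,v\in V(G)$, $uv\in E(G)$ iff $D(\ell(u),\ell(v))=1$. (That is, $G$ admits an $O(dh\log n)$-bit adjacency labeling scheme.)
   Context: $\log$ is base 2. Rooted trees: $u\preceq_T u'$ means $u$ is an ancestor of $u'$ (possibly equal), $u\prec_T u'$ a strict ancestor. For unordered pairs, $uv\preceq_T u'v'$ if ($u\preceq_T u'$ and $v\preceq_T v'$) or ($v\preceq_T u'$ and $u\preceq_T v'$); $uv\prec_T u'v'$ if moreover $\{u,v\}\ne\{u',v'\}$. A full binary tree is a rooted tree whose non-leaf nodes have exactly two children; $L(T)$ is its leaf set; its depth is the maximum number of nodes on a root-to-leaf path. A transversal pair of $T$ is an unordered pair of nodes neither of which is an ancestor of the other. Two transversal pairs $uv,u'v'$ cross if $u\prec_T u'$ and $v'\prec_T v$, or $u'\prec_T u$ and $v\prec_T v'$, or $u\prec_T v'$ and $u'\prec_T v$, or $v'\prec_T u$ and $v\prec_T u'$. A signed tree model is a triple $(T,A(T),B(T))$ where $T$ is a full binary tree and $A(T)$, $B(T)$ are disjoint sets of transversal pairs of $T$ such that no two pairs in $A(T)\cup B(T)$ cross. It defines the graph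 on vertex set $L(T)$ in which leaves $u,v$ are adjacent iff there is $u'v'\in B(T)$ with $u'v'\preceq_T uv$ and no $u''v''\in A(T)$ with $u'v'\prec_T u''v''\preceq_T uv$; a graph $G$ has the signed tree model if $L(T)=V(G)$ and the defined graph is $G$. Its width is the degeneracy of the graph $(V(T),A(T)\cup B(T))$. -}

module Defs where

open import Data.Nat using (ℕ; suc; _≤_; _<_; _⊔_)
open import Data.Fin using (Fin)
open import Data.Bool using (Bool; true)
open import Data.List using (List; length)
open import Data.List.Membership.Propositional using (_∈_)
open import Data.Product using (_×_; _,_; Σ; ∃; ∃-syntax)
open import Data.Sum using (_⊎_)
open import Data.Unit using (⊤)
open import Data.Empty using (⊥)
open import Relation.Nullary using (¬_)
open import Relation.Binary.PropositionalEquality using (_≡_; _≢_)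

data BTree : Set where
  lf : BTree
  nd : BTree → BTree → BTree

data Node : BTree → Set where
  here  : ∀ {t} → Node t
  left  : ∀ {l r} → Node l → Node (nd l r)
  right : ∀ {l r} → Node r → Node (nd l r)

IsLeaf : ∀ {t} → Node t → Set
IsLeaf {lf}     here      = ⊤
IsLeaf {nd _ _} here      = ⊥
IsLeaf          (left p)  = IsLeaf p
IsLeaf          (right p) = IsLeaf p

-- depth = maximum number of nodes on a root-to-leaf path
depth : BTree → ℕ
depth lf       = 1
depth (nd l r) = suc (depth l ⊔ depth r)

data _≼_ : ∀ {t} → Node t → Node t → Set where
  here≼  : ∀ {t} {v : Node t} → here ≼ v
  left≼  : ∀ {l r} {u v : Node l} → u ≼ v → left {l} {r} u ≼ left v
  right≼ : ∀ {l r} {u v : Node r} → u ≼ v → right {l} {r} u ≼ right v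

_≺_ : ∀ {t} → Node t → Node t → Set
u ≺ v = u ≼ v × u ≢ v

-- Unordered pairs are represented by ordered pairs (u , v); all notions
-- below are invariant under swapping the components.

Pair : BTree → Set
Pair t = Node t × Node t

SamePair : ∀ {t} → Pair t → Pair t → Set
SamePair (u , v) (u' , v') = (u ≡ u' × v ≡ v') ⊎ (u ≡ v' × v ≡ u')

_⪯_ : ∀ {t} → Pair t → Pair t → Set
(u , v) ⪯ (u' , v') = (u ≼ u' × v ≼ v') ⊎ (v ≼ u' × u ≼ v')

_⪯≠_ : ∀ {t} → Pair t → Pair t → Set
p ⪯≠ q = p ⪯ q × ¬ SamePair p q

Transversal : ∀ {t} → Pair t → Set
Transversal (u , v) = ¬ (u ≼ v) × ¬ (v ≼ u)

Cross : ∀ {t} → Pair t → Pair t → Set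
Cross (u , v) (u' , v') =
  (u ≺ u' × v' ≺ v) ⊎ (u' ≺ u × v ≺ v') ⊎ (u ≺ v' × u' ≺ v) ⊎ (v' ≺ u × v ≺ u')

_∈ᵘ_ : ∀ {t} → Pair t → List (Pair t) → Set
p ∈ᵘ L = ∃[ q ] (q ∈ L × SamePair p q)

-- every nonempty (induced) subgraph, given by S, has a vertex with at most
-- k neighbours inside S (neighbours counted via a covering list of length ≤ k)
Degenerate : ∀ {X : Set} → (X → X → Set) → ℕ → Set
Degenerate {X} adj k =
  (S : X → Bool) → (∃[ x ] S x ≡ true) →
  ∃[ v ] (S v ≡ true ×
    ∃[ N ] (length N ≤ k × (∀ w → S w ≡ true → adj v w → w ∈ N)))

HasDegeneracy : ∀ {X : Set} → (X → X → Set) → ℕ → Set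
HasDegeneracy adj k = Degenerate adj k × (∀ j → j < k → ¬ Degenerate adj j)

record SimpleGraph (n : ℕ) : Set₁ where
  field
    Adj    : Fin n → Fin n → Set
    sym    : ∀ {u v} → Adj u v → Adj v u
    irrefl : ∀ {u} → ¬ Adj u u

record SignedTreeModel (n : ℕ) : Set where
  field
    T      : BTree
    leaf   : Fin n → Node T
    leaf-isLeaf : ∀ v → IsLeaf (leaf v)
    leaf-inj    : ∀ u v → leaf u ≡ leaf v → u ≡ v
    leaf-onto   : ∀ x → IsLeaf x → ∃[ v ] leaf v ≡ x
    A      : List (Pair T)
    B      : List (Pair T)
    A-transversal : ∀ p → p ∈ A → Transversal p
    B-transversal : ∀ p → p ∈ B → Transversal p
    disjoint      : ∀ p → p ∈ A → ¬ (p ∈ᵘ B)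
    noCross       : ∀ p q → p ∈ᵘ (A Data.List.++ B) → q ∈ᵘ (A Data.List.++ B) → ¬ Cross p q

  ABAdj : Node T → Node T → Set
  ABAdj x y = (x , y) ∈ᵘ (A Data.List.++ B)

  width-is : ℕ → Set
  width-is d = HasDegeneracy ABAdj d

  ModelAdj : Fin n → Fin n → Set
  ModelAdj u v =
    ∃[ p ] (p ∈ B × p ⪯ (leaf u , leaf v) ×
      ¬ (∃[ q ] (q ∈ A × p ⪯≠ q × q ⪯ (leaf u , leaf v))))

HasModel : ∀ {n} → SimpleGraph n → SignedTreeModel n → Set
HasModel G M = ∀ u v →
  (SimpleGraph.Adj G u v → SignedTreeModel.ModelAdj M u v) ×
  (SignedTreeModel.ModelAdj M u v → SimpleGraph.Adj G u v)

-- Orient the graph (V(T), A ∪ B) so that every node has out-degree at most d, as a degeneracy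
-- ordering allows. The label of a leaf x lists the ancestors of x (at most h of them) in order of
-- depth and, for every ancestor y, the signed pairs yz ∈ A ∪ B with z an out-neighbour of y (at most
-- d each); each node is named by two leaf indices, O(log n) bits. A pair p ⪯ uv joins an ancestor
-- of u to an ancestor of v and is stored with u or with v, so the decoder sees every such pair, as
-- the depths of its ends in the two ancestor chains. For transversal pairs below a fixed uv, ⪯ is
-- comparison of these depths in each coordinate, so uv is an edge iff some B-pair found this way is
-- not dominated by a different A-pair found this way.

module Submission where

open import Defs
open import Data.Nat using (ℕ; _≤_; _*_)
open import Data.Nat.Logarithm using (⌈log₂_⌉)
open import Data.Fin using (Fin)
open import Data.Bool using (Bool; true)
open import Data.List using (List; length)
open import Data.Product using (_×_; _,_; Σ; ∃; ∃-syntax)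
open import Relation.Binary.PropositionalEquality using (_≡_; _≢_)
open import Function.Bundles using (_⇔_)
open import Data.Nat using (zero; suc; _+_; _^_; _∸_; _<_; _≤?_; z≤n; s≤s; ⌊_/2⌋; ⌈_/2⌉)
import Data.Nat as ℕ
open import Data.Nat.Properties
open import Data.Nat.Logarithm using (⌈log₂⌈n/2⌉⌉≡⌈log₂n⌉∸1; ⌈log₂⌉-mono-≤)
open import Data.Nat.Induction using (<-rec)
open import Data.Nat.Tactic.RingSolver using (solve-∀)
open import Data.Fin using (zero; suc; remQuot; combine; inject≤)
open import Data.Fin.Properties using (combine-remQuot; inject≤-injective)
open import Data.Bool using (false; if_then_else_)
import Data.Bool as Bool
open import Data.Maybe using (Maybe; just; nothing)
import Data.Maybe as Maybe
open import Data.Maybe.Properties using (just-injective)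
open import Data.List using ([]; _∷_; _++_; map; mapMaybe; head; filter; concatMap)
open import Data.List.Properties
  using (≡-dec; ∷-injective; map-++; map-∘; map-cong; ++-identityʳ; length-++; length-map; filter-notAll;
         mapMaybe-++; mapMaybe-map-retract; mapMaybe-map; mapMaybe-cong; mapMaybe-nothing; length-mapMaybe)
open import Data.List.Membership.Propositional using (_∈_; find; lose)
open import Data.List.Membership.Propositional.Properties
  using (∈-filter⁺; ∈-map⁺; ∈-map⁻; ∈-++⁺ˡ; ∈-++⁺ʳ; ∈-++⁻; ∈-concatMap⁺; ∈-concatMap⁻)
open import Data.List.Relation.Unary.Any using (Any; here; there; any?)
import Data.List.Relation.Unary.Any as Any
open import Data.List.Relation.Unary.All using (All; []; _∷_; all?)
import Data.List.Relation.Unary.All as All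
import Data.List.Relation.Unary.All.Properties as All
open import Data.Product using (proj₁; proj₂; ∃₂; uncurry; map₂)
import Data.Product as Product
open import Data.Sum using (_⊎_; inj₁; inj₂; [_,_]′)
open import Data.Unit using (tt)
open import Function using (_∘_)
open import Function.Bundles using (mk⇔)
open import Function.Definitions using (Injective)
open import Function.Properties.Equivalence using () renaming (trans to ⇔-trans)
open import Relation.Binary.Definitions using (DecidableEquality)
open import Relation.Binary.PropositionalEquality
  using (refl; sym; trans; cong; cong₂; subst; subst₂; module ≡-Reasoning)
open import Relation.Nullary using (¬_; Dec; does; yes; no; contradiction; ¬?; _×-dec_; _⊎-dec_)
import Relation.Nullary.Decidable as Dec
open import Relation.Nullary.Decidable using (dec-true)

length-concatMap-≤ : ∀ {A B : Set} {d} (f : A → List B) → (∀ x → length (f x) ≤ d) →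
                     ∀ xs → length (concatMap f xs) ≤ length xs * d
length-concatMap-≤ f f≤d []       = z≤n
length-concatMap-≤ f f≤d (x ∷ xs) =
  ≤-trans (≤-reflexive (length-++ (f x))) (+-mono-≤ (f≤d x) (length-concatMap-≤ f f≤d xs))

module _ {A B : Set} (f : A → Maybe B) where

  ∈-mapMaybe⁺ : ∀ {xs x y} → x ∈ xs → f x ≡ just y → y ∈ mapMaybe f xs
  ∈-mapMaybe⁺ {x ∷ xs} (here refl) fx≡y with f x
  ∈-mapMaybe⁺ {x ∷ xs} (here refl) refl | just _ = here refl
  ∈-mapMaybe⁺ {x ∷ xs} (there x∈)  fx≡y with f x
  ... | just _  = there (∈-mapMaybe⁺ x∈ fx≡y)
  ... | nothing = ∈-mapMaybe⁺ x∈ fx≡y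

  ∈-mapMaybe⁻ : ∀ xs {y} → y ∈ mapMaybe f xs → ∃[ x ] (x ∈ xs × f x ≡ just y)
  ∈-mapMaybe⁻ (x ∷ xs) y∈ with f x in fx≡
  ∈-mapMaybe⁻ (x ∷ xs) (here refl) | just _ = x , here refl , fx≡
  ∈-mapMaybe⁻ (x ∷ xs) (there y∈)  | just _ = let x′ , x′∈ , fx′≡ = ∈-mapMaybe⁻ xs y∈ in x′ , there x′∈ , fx′≡
  ∈-mapMaybe⁻ (x ∷ xs) y∈          | nothing = let x′ , x′∈ , fx′≡ = ∈-mapMaybe⁻ xs y∈ in x′ , there x′∈ , fx′≡

mapMaybe-map-nothing : ∀ {A B C : Set} (f : B → Maybe C) (g : A → B) →
                       (∀ x → f (g x) ≡ nothing) → ∀ xs → mapMaybe f (map g xs) ≡ []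
mapMaybe-map-nothing f g fg≡nothing xs =
  trans (mapMaybe-map f g xs) (trans (mapMaybe-cong fg≡nothing xs) (mapMaybe-nothing xs))

dec-true⁻ : ∀ {A : Set} (a? : Dec A) → does a? ≡ true → A
dec-true⁻ (yes a) _ = a

bit : Fin 2 → Bool
bit zero       = false
bit (suc zero) = true

bit-injective : Injective _≡_ _≡_ bit
bit-injective {zero}     {zero}     _ = refl
bit-injective {zero}     {suc zero} ()
bit-injective {suc zero} {zero}     ()
bit-injective {suc zero} {suc zero} _ = refl

bits : ∀ w → Fin (2 ^ w) → List Bool
bits zero    _ = []
bits (suc w) i = bit (proj₁ (remQuot {2} (2 ^ w) i)) ∷ bits w (proj₂ (remQuot {2} (2 ^ w) i))

length-bits : ∀ w i → length (bits w i) ≡ w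
length-bits zero    _ = refl
length-bits (suc w) i = cong suc (length-bits w _)

bits-injective : ∀ w → Injective _≡_ _≡_ (bits w)
bits-injective zero {zero} {zero} _ = refl
bits-injective (suc w) {i} {j} eq =
  trans (sym (combine-remQuot {2} (2 ^ w) i))
    (trans (cong (uncurry combine) remQuot≡) (combine-remQuot {2} (2 ^ w) j))
  where
  remQuot≡ : remQuot {2} (2 ^ w) i ≡ remQuot (2 ^ w) j
  remQuot≡ = cong₂ _,_ (bit-injective (proj₁ (∷-injective eq)))
                       (bits-injective w (proj₂ (∷-injective eq)))

n≤2^⌈log₂n⌉ : ∀ n → n ≤ 2 ^ ⌈log₂ n ⌉
n≤2^⌈log₂n⌉ = <-rec _ step
  where
  step : ∀ n → (∀ {m} → m < n → m ≤ 2 ^ ⌈log₂ m ⌉) → n ≤ 2 ^ ⌈log₂ n ⌉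
  step zero          _  = z≤n
  step (suc zero)    _  = s≤s z≤n
  step (suc (suc n)) ih = begin
    2 + n                                ≡⟨ ⌊n/2⌋+⌈n/2⌉≡n (2 + n) ⟨
    ⌊ 2 + n /2⌋ + ⌈ 2 + n /2⌉             ≤⟨ +-monoˡ-≤ _ (⌊n/2⌋≤⌈n/2⌉ (2 + n)) ⟩
    ⌈ 2 + n /2⌉ + ⌈ 2 + n /2⌉             ≡⟨ cong (⌈ 2 + n /2⌉ +_) (+-identityʳ _) ⟨
    2 * ⌈ 2 + n /2⌉                      ≤⟨ *-monoʳ-≤ 2 (ih (s≤s (s≤s (⌈n/2⌉≤n n)))) ⟩
    2 * 2 ^ ⌈log₂ ⌈ 2 + n /2⌉ ⌉          ≡⟨ cong (λ k → 2 * 2 ^ k) (⌈log₂⌈n/2⌉⌉≡⌈log₂n⌉∸1 (2 + n)) ⟩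
    2 * 2 ^ (⌈log₂ (2 + n) ⌉ ∸ 1)         ≡⟨⟩  -- ⌈log₂ (2 + n)⌉ computes to a successor
    2 ^ ⌈log₂ (2 + n) ⌉                   ∎
    where open ≤-Reasoning

binary : ∀ {n} → Fin n → List Bool
binary {n} i = bits ⌈log₂ n ⌉ (inject≤ i (n≤2^⌈log₂n⌉ n))

binary-injective : ∀ {n} → Injective _≡_ _≡_ (binary {n})
binary-injective {n} eq = inject≤-injective _ _ _ _ (bits-injective ⌈log₂ n ⌉ eq)

length-binary : ∀ {n} (i : Fin n) → length (binary i) ≡ ⌈log₂ n ⌉
length-binary {n} i = length-bits ⌈log₂ n ⌉ _

-- A self-delimiting encoding of lists of bit strings

escape : List Bool → List Bool → List Bool
escape []      rest = false ∷ rest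
escape (b ∷ s) rest = true ∷ b ∷ escape s rest

encode : List (List Bool) → List Bool
encode []       = []
encode (s ∷ ss) = escape s (encode ss)

decode : List Bool → List (List Bool)
decode []               = []
decode (false ∷ bs)     = [] ∷ decode bs
decode (true ∷ [])      = []
decode (true ∷ b ∷ bs)  with decode bs
... | []     = (b ∷ []) ∷ []
... | s ∷ ss = (b ∷ s) ∷ ss

decode-escape : ∀ s rest → decode (escape s rest) ≡ s ∷ decode rest
decode-escape []      rest = refl
decode-escape (b ∷ s) rest rewrite decode-escape s rest = refl

decode-encode : ∀ ss → decode (encode ss) ≡ ss
decode-encode []       = refl
decode-encode (s ∷ ss) = trans (decode-escape s (encode ss)) (cong (s ∷_) (decode-encode ss))

encode-injective : Injective _≡_ _≡_ encode
encode-injective {ss} {ts} eq =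
  trans (sym (decode-encode ss)) (trans (cong decode eq) (decode-encode ts))

length-escape : ∀ s rest → length (escape s rest) ≡ suc (2 * length s) + length rest
length-escape []      rest = refl
length-escape (b ∷ s) rest =
  trans (cong (2 +_) (length-escape s rest)) (cong (λ k → suc k + length rest) (sym (*-suc 2 (length s))))

length-encode-≤ : ∀ {m} ss → All (λ s → length s ≤ m) ss → length (encode ss) ≤ length ss * suc (2 * m)
length-encode-≤ [] [] = z≤n
length-encode-≤ {m} (s ∷ ss) (s≤m ∷ ss≤m) = begin
  length (escape s (encode ss))          ≡⟨ length-escape s (encode ss) ⟩
  suc (2 * length s) + length (encode ss) ≤⟨ +-mono-≤ (s≤s (*-monoʳ-≤ 2 s≤m)) (length-encode-≤ ss ss≤m) ⟩
  suc (2 * m) + length ss * suc (2 * m)   ∎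
  where open ≤-Reasoning

Label : Set → Set
Label X = List X × List (Bool × X × X)

mapLabel : ∀ {X Y : Set} → (X → Y) → Label X → Label Y
mapLabel f (us , ps) = map f us , map (map₂ (Product.map f f)) ps

-- The two kinds of record are told apart by their number of fields.
ancestorRecord : List Bool → List (List Bool)
ancestorRecord c = c ∷ []

pairRecord : Bool × List Bool × List Bool → List (List Bool)
pairRecord (s , a , b) = (s ∷ []) ∷ a ∷ b ∷ []

asAncestor : List (List Bool) → Maybe (List Bool)
asAncestor (c ∷ []) = just c
asAncestor _        = nothing

asPair : List (List Bool) → Maybe (Bool × List Bool × List Bool)
asPair (sign ∷ a ∷ b ∷ []) = Maybe.map (_, a , b) (head sign)
asPair _                   = nothing

serialize : Label (List Bool) → List Bool
serialize (cs , ps) = encode (map (encode ∘ ancestorRecord) cs ++ map (encode ∘ pairRecord) ps)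

parse : List Bool → Label (List Bool)
parse ℓ = mapMaybe asAncestor records , mapMaybe asPair records
  where records = map decode (decode ℓ)

parse-serialize : ∀ l → parse (serialize l) ≡ l
parse-serialize (cs , ps) = begin
  parse (serialize (cs , ps))
    ≡⟨ cong (λ rs → mapMaybe asAncestor rs , mapMaybe asPair rs) records≡ ⟩
  mapMaybe asAncestor (ancestorRecords ++ pairRecords) , mapMaybe asPair (ancestorRecords ++ pairRecords)
    ≡⟨ cong₂ _,_ (mapMaybe-++ asAncestor ancestorRecords pairRecords) (mapMaybe-++ asPair ancestorRecords pairRecords) ⟩
  mapMaybe asAncestor ancestorRecords ++ mapMaybe asAncestor pairRecords ,
  mapMaybe asPair ancestorRecords ++ mapMaybe asPair pairRecords
    ≡⟨ cong₂ _,_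
         (cong₂ _++_ (mapMaybe-map-retract (λ _ → refl) cs) (mapMaybe-map-nothing asAncestor pairRecord (λ _ → refl) ps))
         (cong₂ _++_ (mapMaybe-map-nothing asPair ancestorRecord (λ _ → refl) cs) (mapMaybe-map-retract (λ _ → refl) ps)) ⟩
  cs ++ [] , ps
    ≡⟨ cong (_, ps) (++-identityʳ cs) ⟩
  cs , ps ∎
  where
  open ≡-Reasoning
  ancestorRecords = map ancestorRecord cs
  pairRecords     = map pairRecord ps
  decode-encode-map : ∀ {A : Set} (r : A → List (List Bool)) xs → map decode (map (encode ∘ r) xs) ≡ map r xs
  decode-encode-map r xs = trans (sym (map-∘ xs)) (map-cong (decode-encode ∘ r) xs)
  records≡ : map decode (decode (serialize (cs , ps))) ≡ ancestorRecords ++ pairRecords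
  records≡ = begin
    map decode (decode (serialize (cs , ps)))
      ≡⟨ cong (map decode) (decode-encode _) ⟩
    map decode (map (encode ∘ ancestorRecord) cs ++ map (encode ∘ pairRecord) ps)
      ≡⟨ map-++ decode (map _ cs) _ ⟩
    map decode (map (encode ∘ ancestorRecord) cs) ++ map decode (map (encode ∘ pairRecord) ps)
      ≡⟨ cong₂ _++_ (decode-encode-map ancestorRecord cs) (decode-encode-map pairRecord ps) ⟩
    ancestorRecords ++ pairRecords ∎

recordCost : ℕ → ℕ
recordCost K = suc (2 * (3 * suc (2 * suc K)))

length-serialize-≤ : ∀ {X : Set} {K} (code : X → List Bool) → (∀ x → length (code x) ≤ K) →
                     ∀ us ps → length (serialize (mapLabel code (us , ps))) ≤ (length us + length ps) * recordCost K
length-serialize-≤ {K = K} code code≤K us ps = begin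
  length (encode records)                    ≤⟨ length-encode-≤ records records≤ ⟩
  length records * suc (2 * recordBound)     ≡⟨ cong (_* suc (2 * recordBound)) length-records ⟩
  (length us + length ps) * suc (2 * recordBound) ∎
  where
  open ≤-Reasoning
  recordBound = 3 * suc (2 * suc K)
  ancestorRecords = map (encode ∘ ancestorRecord) (map code us)
  pairRecords = map (encode ∘ pairRecord) (map (map₂ (Product.map code code)) ps)
  records = ancestorRecords ++ pairRecords
  length-records : length records ≡ length us + length ps
  length-records = trans (length-++ ancestorRecords)
    (cong₂ _+_ (trans (length-map _ (map code us)) (length-map code us))
               (trans (length-map _ (map _ ps)) (length-map _ ps)))
  field≤ : ∀ x → length (code x) ≤ suc K
  field≤ x = m≤n⇒m≤1+n (code≤K x)
  records≤ : All (λ r → length r ≤ recordBound) records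
  records≤ = All.++⁺ (All.map⁺ (All.map⁺ (All.universal ancestor≤ us))) (All.map⁺ (All.map⁺ (All.universal pair≤ ps)))
    where
    ancestor≤ : ∀ u → length (encode (ancestorRecord (code u))) ≤ recordBound
    ancestor≤ u = ≤-trans (length-encode-≤ (ancestorRecord (code u)) (field≤ u ∷ []))
                          (*-monoˡ-≤ (suc (2 * suc K)) (s≤s {0} {2} z≤n))
    pair≤ : ∀ (p : Bool × _ × _) → length (encode (pairRecord (map₂ (Product.map code code) p))) ≤ recordBound
    pair≤ (s , y , z) = length-encode-≤ (pairRecord (s , code y , code z)) (s≤s z≤n ∷ field≤ y ∷ field≤ z ∷ [])

module _ {X : Set} (_≟_ : DecidableEquality X) where

  indexOf : List X → X → Maybe ℕ
  indexOf []       y = nothing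
  indexOf (x ∷ xs) y = if does (y ≟ x) then just 0 else Maybe.map suc (indexOf xs y)

  indexOf-just⇒∈ : ∀ xs {y i} → indexOf xs y ≡ just i → y ∈ xs
  indexOf-just⇒∈ (x ∷ xs) {y} eq with y ≟ x | indexOf xs y in eq′
  ... | yes y≡x | _      = here y≡x
  ... | no _    | just _ = there (indexOf-just⇒∈ xs eq′)

  locate : List X → List X → Bool × X × X → Maybe (Bool × ℕ × ℕ)
  locate us vs (s , y , z) = Maybe.zipWith (λ i j → s , i , j) (indexOf us y) (indexOf vs z)

  locate⁻ : ∀ us vs {s y z g} → locate us vs (s , y , z) ≡ just g →
            ∃₂ λ i j → indexOf us y ≡ just i × indexOf vs z ≡ just j × g ≡ (s , i , j)
  locate⁻ us vs {y = y} {z} eq with indexOf us y | indexOf vs z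
  locate⁻ us vs refl | just i | just j = i , j , refl , refl , refl

  locate-just : ∀ us vs {s y z i j} → indexOf us y ≡ just i → indexOf vs z ≡ just j →
                locate us vs (s , y , z) ≡ just (s , i , j)
  locate-just us vs y↦i z↦j rewrite y↦i | z↦j = refl

  -- A label lists ancestors in order of depth and signed pairs (s , y , z) with y among them. The signed
  -- pairs of both labels whose ends are ancestors of u and of v are returned as (s , depth of the end
  -- above u , depth of the end above v); pairs from the label of v have their ends the other way round.
  relevant : Label X → Label X → List (Bool × ℕ × ℕ)
  relevant (us , ps) (vs , qs) = mapMaybe (locate us vs) ps ++ mapMaybe (locate us vs ∘ map₂ Product.swap) qs

indexOf-map : ∀ {X Y : Set} (_≟X_ : DecidableEquality X) (_≟Y_ : DecidableEquality Y) {f : X → Y} →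
              Injective _≡_ _≡_ f → ∀ xs y → indexOf _≟Y_ (map f xs) (f y) ≡ indexOf _≟X_ xs y
indexOf-map _≟X_ _≟Y_ {f} f-inj []       y = refl
indexOf-map _≟X_ _≟Y_ {f} f-inj (x ∷ xs) y
  rewrite indexOf-map _≟X_ _≟Y_ f-inj xs y with y ≟X x | f y ≟Y f x
... | yes _   | yes _    = refl
... | no  _   | no  _    = refl
... | yes y≡x | no fy≢fx = contradiction (cong f y≡x) fy≢fx
... | no  y≢x | yes fy≡fx = contradiction (f-inj fy≡fx) y≢x

relevant-mapLabel : ∀ {X Y : Set} (_≟X_ : DecidableEquality X) (_≟Y_ : DecidableEquality Y) {f : X → Y} →
                    Injective _≡_ _≡_ f → ∀ l l′ →
                    relevant _≟Y_ (mapLabel f l) (mapLabel f l′) ≡ relevant _≟X_ l l′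
relevant-mapLabel {X} _≟X_ _≟Y_ {f} f-inj (us , ps) (vs , qs) = cong₂ _++_
  (trans (mapMaybe-map _ _ ps) (mapMaybe-cong located ps))
  (trans (mapMaybe-map _ _ qs) (mapMaybe-cong (located ∘ map₂ Product.swap) qs))
  where
  located : ∀ (p : Bool × X × X) →
            locate _≟Y_ (map f us) (map f vs) (map₂ (Product.map f f) p) ≡ locate _≟X_ us vs p
  located (s , y , z) = cong₂ (Maybe.zipWith (λ i j → s , i , j)) (indexOf-map _≟X_ _≟Y_ f-inj us y) (indexOf-map _≟X_ _≟Y_ f-inj vs z)

Blocks : Bool × ℕ × ℕ → Bool × ℕ × ℕ → Set
Blocks (_ , i , j) (s′ , i′ , j′) = s′ ≡ false × i ≤ i′ × j ≤ j′ × ¬ (i ≡ i′ × j ≡ j′)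

blocks? : ∀ p q → Dec (Blocks p q)
blocks? (_ , i , j) (s′ , i′ , j′) =
  s′ Bool.≟ false ×-dec i ≤? i′ ×-dec j ≤? j′ ×-dec ¬? (i ℕ.≟ i′ ×-dec j ℕ.≟ j′)

Unblocked : List (Bool × ℕ × ℕ) → Bool × ℕ × ℕ → Set
Unblocked R p = All (¬_ ∘ Blocks p) R

Adjacent : List (Bool × ℕ × ℕ) → Set
Adjacent R = Any (λ p → proj₁ p ≡ true × Unblocked R p) R

adjacent? : ∀ R → Dec (Adjacent R)
adjacent? R = any? (λ p → proj₁ p Bool.≟ true ×-dec all? (¬? ∘ blocks? p) R) R

decoder : List Bool → List Bool → Bool
decoder ℓ ℓ′ = does (adjacent? (relevant (≡-dec Bool._≟_) (parse ℓ) (parse ℓ′)))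

-- Orienting a degenerate graph

module _ {X : Set} (_≟_ : DecidableEquality X) {adj : X → X → Set}
         (adj-sym : ∀ {x y} → adj x y → adj y x) {d} (deg : Degenerate adj d) where
  open import Data.List.Membership.DecPropositional _≟_ using (_∈?_)

  remove : X → List X → List X
  remove v = filter (λ y → ¬? (y ≟ v))

  length-remove : ∀ {v xs} → v ∈ xs → length (remove v xs) < length xs
  length-remove {v} {xs} v∈xs = filter-notAll (λ y → ¬? (y ≟ v)) xs (Any.map (λ v≡y y≢v → y≢v (sym v≡y)) v∈xs)

  ∈-remove⁺ : ∀ {v y xs} → y ∈ xs → y ≢ v → y ∈ remove v xs
  ∈-remove⁺ {v} = ∈-filter⁺ (λ y → ¬? (y ≟ v))

  Orientation : List X → Set
  Orientation xs = Σ (X → List X) λ out → (∀ x → length (out x) ≤ d) ×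
                   (∀ {x y} → x ∈ xs → y ∈ xs → adj x y → y ∈ out x ⊎ x ∈ out y)

  orientation-≤ : ∀ k xs → length xs ≤ k → Orientation xs
  orientation-≤ _       []            _    = (λ _ → []) , (λ _ → z≤n) , λ ()
  orientation-≤ (suc k) xs@(x ∷ _) |xs|≤ with deg (λ y → does (y ∈? xs)) (x , dec-true (x ∈? xs) (here refl))
  ... | v , v∈ , N , |N|≤d , N-covers
      with orientation-≤ k (remove v xs) (≤-pred (≤-trans (length-remove (dec-true⁻ (v ∈? xs) v∈)) |xs|≤))
  ... | out′ , out′≤ , covers′ = out , out≤ , covers
    where
    out : X → List X
    out y = if does (y ≟ v) then N else out′ y
    out≤ : ∀ y → length (out y) ≤ d
    out≤ y with y ≟ v
    ... | yes _ = |N|≤d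
    ... | no  _ = out′≤ y
    covers : ∀ {y z} → y ∈ xs → z ∈ xs → adj y z → z ∈ out y ⊎ y ∈ out z
    covers {y} {z} y∈ z∈ yz with y ≟ v | z ≟ v
    ... | yes refl | _        = inj₁ (N-covers z (dec-true (z ∈? xs) z∈) yz)
    ... | no  _    | yes refl = inj₂ (N-covers y (dec-true (y ∈? xs) y∈) (adj-sym yz))
    ... | no  y≢v  | no  z≢v  = covers′ (∈-remove⁺ y∈ y≢v) (∈-remove⁺ z∈ z≢v) yz

  orientation : ∀ xs → Orientation xs
  orientation xs = orientation-≤ (length xs) xs ≤-refl

module _ {l r : BTree} where
  left-injective : ∀ {x y : Node l} → left {r = r} x ≡ left y → x ≡ y
  left-injective refl = refl

  right-injective : ∀ {x y : Node r} → right {l} x ≡ right y → x ≡ y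
  right-injective refl = refl

_≟ₙ_ : ∀ {t} → DecidableEquality (Node t)
here    ≟ₙ here     = yes refl
here    ≟ₙ left _   = no λ ()
here    ≟ₙ right _  = no λ ()
left _  ≟ₙ here     = no λ ()
left _  ≟ₙ right _  = no λ ()
right _ ≟ₙ here     = no λ ()
right _ ≟ₙ left _   = no λ ()
left x  ≟ₙ left y   = Dec.map′ (cong left) left-injective (x ≟ₙ y)
right x ≟ₙ right y  = Dec.map′ (cong right) right-injective (x ≟ₙ y)

level : ∀ {t} → Node t → ℕ
level here      = 0
level (left x)  = suc (level x)
level (right x) = suc (level x)

level<depth : ∀ {t} (x : Node t) → level x < depth t
level<depth {lf}     here      = s≤s z≤n
level<depth {nd _ _} here      = s≤s z≤n
level<depth {nd _ _} (left x)  = s≤s (≤-trans (level<depth x) (m≤m⊔n _ _))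
level<depth {nd _ _} (right x) = s≤s (≤-trans (level<depth x) (m≤n⊔m _ _))

ancestors : ∀ {t} → Node t → List (Node t)
ancestors here      = here ∷ []
ancestors (left x)  = here ∷ map left (ancestors x)
ancestors (right x) = here ∷ map right (ancestors x)

length-ancestors : ∀ {t} (x : Node t) → length (ancestors x) ≡ suc (level x)
length-ancestors here      = refl
length-ancestors (left x)  = cong suc (trans (length-map left (ancestors x)) (length-ancestors x))
length-ancestors (right x) = cong suc (trans (length-map right (ancestors x)) (length-ancestors x))

∈-ancestors⁺ : ∀ {t} {x y : Node t} → y ≼ x → y ∈ ancestors x
∈-ancestors⁺ {x = here}    here≼      = here refl
∈-ancestors⁺ {x = left _}  here≼      = here refl
∈-ancestors⁺ {x = right _} here≼      = here refl
∈-ancestors⁺               (left≼ p)  = there (∈-map⁺ left (∈-ancestors⁺ p))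
∈-ancestors⁺               (right≼ p) = there (∈-map⁺ right (∈-ancestors⁺ p))

∈-ancestors⁻ : ∀ {t} {x y : Node t} → y ∈ ancestors x → y ≼ x
∈-ancestors⁻ {x = here}    (here refl) = here≼
∈-ancestors⁻ {x = left _}  (here refl) = here≼
∈-ancestors⁻ {x = right _} (here refl) = here≼
∈-ancestors⁻ {x = left x}  (there y∈) with ∈-map⁻ left y∈
... | _ , y′∈ , refl = left≼ (∈-ancestors⁻ y′∈)
∈-ancestors⁻ {x = right x} (there y∈) with ∈-map⁻ right y∈
... | _ , y′∈ , refl = right≼ (∈-ancestors⁻ y′∈)

indexOf-ancestors : ∀ {t} {x y : Node t} → y ≼ x → indexOf _≟ₙ_ (ancestors x) y ≡ just (level y)
indexOf-ancestors {x = here}    here≼ = refl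
indexOf-ancestors {x = left _}  here≼ = refl
indexOf-ancestors {x = right _} here≼ = refl
indexOf-ancestors {x = left x}  {left y}  (left≼ p) =
  cong (Maybe.map suc) (trans (indexOf-map _≟ₙ_ _≟ₙ_ left-injective (ancestors x) y) (indexOf-ancestors p))
indexOf-ancestors {x = right x} {right y} (right≼ p) =
  cong (Maybe.map suc) (trans (indexOf-map _≟ₙ_ _≟ₙ_ right-injective (ancestors x) y) (indexOf-ancestors p))

≼-antisym : ∀ {t} {x y : Node t} → x ≼ y → y ≼ x → x ≡ y
≼-antisym here≼      here≼      = refl
≼-antisym (left≼ p)  (left≼ q)  = cong left (≼-antisym p q)
≼-antisym (right≼ p) (right≼ q) = cong right (≼-antisym p q)

≼-trans : ∀ {t} {x y z : Node t} → x ≼ y → y ≼ z → x ≼ z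
≼-trans here≼      _          = here≼
≼-trans (left≼ p)  (left≼ q)  = left≼ (≼-trans p q)
≼-trans (right≼ p) (right≼ q) = right≼ (≼-trans p q)

≼⇒level≤ : ∀ {t} {x y : Node t} → x ≼ y → level x ≤ level y
≼⇒level≤ here≼      = z≤n
≼⇒level≤ (left≼ p)  = s≤s (≼⇒level≤ p)
≼⇒level≤ (right≼ p) = s≤s (≼⇒level≤ p)

level≤⇒≼ : ∀ {t} {x y z : Node t} → x ≼ z → y ≼ z → level x ≤ level y → x ≼ y
level≤⇒≼ here≼      _          _         = here≼
level≤⇒≼ (left≼ p)  (left≼ q)  (s≤s x≤y) = left≼ (level≤⇒≼ p q x≤y)
level≤⇒≼ (right≼ p) (right≼ q) (s≤s x≤y) = right≼ (level≤⇒≼ p q x≤y)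

level≡⇒≡ : ∀ {t} {x y z : Node t} → x ≼ z → y ≼ z → level x ≡ level y → x ≡ y
level≡⇒≡ x≼z y≼z eq = ≼-antisym (level≤⇒≼ x≼z y≼z (≤-reflexive eq)) (level≤⇒≼ y≼z x≼z (≤-reflexive (sym eq)))

≼-total : ∀ {t} {x y z : Node t} → x ≼ z → y ≼ z → x ≼ y ⊎ y ≼ x
≼-total {x = x} {y} x≼z y≼z with ≤-total (level x) (level y)
... | inj₁ x≤y = inj₁ (level≤⇒≼ x≼z y≼z x≤y)
... | inj₂ y≤x = inj₂ (level≤⇒≼ y≼z x≼z y≤x)

allNodes : ∀ t → List (Node t)
allNodes lf       = here ∷ []
allNodes (nd l r) = here ∷ map left (allNodes l) ++ map right (allNodes r)

∈-allNodes : ∀ {t} (x : Node t) → x ∈ allNodes t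
∈-allNodes {lf}     here      = here refl
∈-allNodes {nd l r} here      = here refl
∈-allNodes {nd l r} (left x)  = there (∈-++⁺ˡ (∈-map⁺ left (∈-allNodes x)))
∈-allNodes {nd l r} (right x) = there (∈-++⁺ʳ _ (∈-map⁺ right (∈-allNodes x)))

leftmostLeaf : ∀ {t} → Node t → Node t
leftmostLeaf {lf}     here      = here
leftmostLeaf {nd l r} here      = left (leftmostLeaf {l} here)
leftmostLeaf          (left x)  = left (leftmostLeaf x)
leftmostLeaf          (right x) = right (leftmostLeaf x)

leftmostRightLeaf : ∀ {t} → Node t → Node t
leftmostRightLeaf {lf}     here      = here
leftmostRightLeaf {nd l r} here      = right (leftmostLeaf {r} here)
leftmostRightLeaf          (left x)  = left (leftmostRightLeaf x)
leftmostRightLeaf          (right x) = right (leftmostRightLeaf x)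

leftmostLeaf-isLeaf : ∀ {t} (x : Node t) → IsLeaf (leftmostLeaf x)
leftmostLeaf-isLeaf {lf}     here      = tt
leftmostLeaf-isLeaf {nd l r} here      = leftmostLeaf-isLeaf {l} here
leftmostLeaf-isLeaf          (left x)  = leftmostLeaf-isLeaf x
leftmostLeaf-isLeaf          (right x) = leftmostLeaf-isLeaf x

leftmostRightLeaf-isLeaf : ∀ {t} (x : Node t) → IsLeaf (leftmostRightLeaf x)
leftmostRightLeaf-isLeaf {lf}     here      = tt
leftmostRightLeaf-isLeaf {nd l r} here      = leftmostLeaf-isLeaf {r} here
leftmostRightLeaf-isLeaf          (left x)  = leftmostRightLeaf-isLeaf x
leftmostRightLeaf-isLeaf          (right x) = leftmostRightLeaf-isLeaf x

leafPair-injective : ∀ {t} {x y : Node t} → leftmostLeaf x ≡ leftmostLeaf y → leftmostRightLeaf x ≡ leftmostRightLeaf y → x ≡ y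
leafPair-injective {lf}     {here}    {here}    _  _  = refl
leafPair-injective {nd l r} {here}    {here}    _  _  = refl
leafPair-injective {nd l r} {here}    {left y}  _  ()
leafPair-injective {nd l r} {here}    {right y} () _
leafPair-injective {nd l r} {left x}  {here}    _  ()
leafPair-injective {nd l r} {right x} {here}    () _
leafPair-injective {nd l r} {left x}  {right y} () _
leafPair-injective {nd l r} {right x} {left y}  () _
leafPair-injective {nd l r} {left x}  {left y}  p  q  = cong left (leafPair-injective (left-injective p) (left-injective q))
leafPair-injective {nd l r} {right x} {right y} p  q  = cong right (leafPair-injective (right-injective p) (right-injective q))

indexOf-ancestors⁻ : ∀ {t} {x y : Node t} {i} → indexOf _≟ₙ_ (ancestors x) y ≡ just i → y ≼ x × level y ≡ i
indexOf-ancestors⁻ {x = x} y↦i = y≼x , just-injective (trans (sym (indexOf-ancestors y≼x)) y↦i)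
  where y≼x = ∈-ancestors⁻ (indexOf-just⇒∈ _≟ₙ_ (ancestors x) y↦i)

module _ {t : BTree} where

  SamePair-sym : {p q : Pair t} → SamePair p q → SamePair q p
  SamePair-sym (inj₁ (refl , refl)) = inj₁ (refl , refl)
  SamePair-sym (inj₂ (refl , refl)) = inj₂ (refl , refl)

  SamePair-trans : {p q r : Pair t} → SamePair p q → SamePair q r → SamePair p r
  SamePair-trans (inj₁ (refl , refl)) q≈r                  = q≈r
  SamePair-trans (inj₂ (refl , refl)) (inj₁ (refl , refl)) = inj₂ (refl , refl)
  SamePair-trans (inj₂ (refl , refl)) (inj₂ (refl , refl)) = inj₁ (refl , refl)

  samePair? : (p q : Pair t) → Dec (SamePair p q)
  samePair? (u , v) (u′ , v′) = (u ≟ₙ u′ ×-dec v ≟ₙ v′) ⊎-dec (u ≟ₙ v′ ×-dec v ≟ₙ u′)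

  _∈ᵘ?_ : (p : Pair t) (ps : List (Pair t)) → Dec (p ∈ᵘ ps)
  p ∈ᵘ? ps = Dec.map′ find (λ (_ , q∈ , p≈q) → lose q∈ p≈q) (any? (samePair? p) ps)

  ∈ᵘ-resp : {p q : Pair t} {ps : List (Pair t)} → SamePair p q → p ∈ᵘ ps → q ∈ᵘ ps
  ∈ᵘ-resp p≈q (r , r∈ , p≈r) = r , r∈ , SamePair-trans (SamePair-sym p≈q) p≈r

  ∈ᵘ-swap : {u v : Node t} {ps : List (Pair t)} → (u , v) ∈ᵘ ps → (v , u) ∈ᵘ ps
  ∈ᵘ-swap = ∈ᵘ-resp (inj₂ (refl , refl))

  Transversal-resp : {p q : Pair t} → SamePair p q → Transversal p → Transversal q
  Transversal-resp (inj₁ (refl , refl)) p-tr              = p-tr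
  Transversal-resp (inj₂ (refl , refl)) (u⋠v , v⋠u) = v⋠u , u⋠v

  ⪯-respˡ : {p p′ q : Pair t} → SamePair p p′ → p ⪯ q → p′ ⪯ q
  ⪯-respˡ (inj₁ (refl , refl)) p⪯q         = p⪯q
  ⪯-respˡ (inj₂ (refl , refl)) (inj₁ p⪯q) = inj₂ p⪯q
  ⪯-respˡ (inj₂ (refl , refl)) (inj₂ p⪯q) = inj₁ p⪯q

  ⪯-respʳ : {p q q′ : Pair t} → SamePair q q′ → p ⪯ q → p ⪯ q′
  ⪯-respʳ (inj₁ (refl , refl)) p⪯q              = p⪯q
  ⪯-respʳ (inj₂ (refl , refl)) (inj₁ (x≼ , y≼)) = inj₂ (y≼ , x≼)
  ⪯-respʳ (inj₂ (refl , refl)) (inj₂ (x≼ , y≼)) = inj₁ (y≼ , x≼)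

  ⪯-oriented : ∀ p {a b : Node t} → p ⪯ (a , b) → ∃₂ λ y z → SamePair p (y , z) × y ≼ a × z ≼ b
  ⪯-oriented (u , v) (inj₁ (u≼a , v≼b)) = u , v , inj₁ (refl , refl) , u≼a , v≼b
  ⪯-oriented (u , v) (inj₂ (v≼a , u≼b)) = v , u , inj₂ (refl , refl) , v≼a , u≼b

  ⪯-componentwise : {a y z y′ z′ : Node t} → Transversal (y , z) → y ≼ a → y′ ≼ a →
                    (y , z) ⪯ (y′ , z′) → y ≼ y′ × z ≼ z′
  ⪯-componentwise _            _   _    (inj₁ ≼≼)           = ≼≼
  ⪯-componentwise (y⋠z , z⋠y) y≼a y′≼a (inj₂ (z≼y′ , _)) with ≼-total y≼a (≼-trans z≼y′ y′≼a)
  ... | inj₁ y≼z = contradiction y≼z y⋠z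
  ... | inj₂ z≼y = contradiction z≼y z⋠y

codeLength : ℕ → ℕ
codeLength L = 2 * suc (2 * L)

module SignedModel {n} (M : SignedTreeModel n) {d} (deg : Degenerate (SignedTreeModel.ABAdj M) d) where
  open SignedTreeModel M

  Signed : Bool → Pair T → Set
  Signed false p = p ∈ᵘ A
  Signed true  p = p ∈ᵘ B

  Signed-resp : ∀ {s p q} → SamePair p q → Signed s p → Signed s q
  Signed-resp {false} = ∈ᵘ-resp
  Signed-resp {true}  = ∈ᵘ-resp

  Signed⇒ABAdj : ∀ {s y z} → Signed s (y , z) → ABAdj y z
  Signed⇒ABAdj {false} (q , q∈ , yz≈q) = q , ∈-++⁺ˡ q∈ , yz≈q
  Signed⇒ABAdj {true}  (q , q∈ , yz≈q) = q , ∈-++⁺ʳ A q∈ , yz≈q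

  ∈ᵘA⇒∉ᵘB : ∀ {p} → p ∈ᵘ A → ¬ p ∈ᵘ B
  ∈ᵘA⇒∉ᵘB (q , q∈A , p≈q) (q′ , q′∈B , p≈q′) = disjoint q q∈A (q′ , q′∈B , SamePair-trans (SamePair-sym p≈q) p≈q′)

  signedTriple : Node T → Node T → Maybe (Bool × Node T × Node T)
  signedTriple y z with (y , z) ∈ᵘ? A | (y , z) ∈ᵘ? B
  ... | yes _ | _     = just (false , y , z)
  ... | no _  | yes _ = just (true , y , z)
  ... | no _  | no _  = nothing

  signedTriple⁻ : ∀ {y z g} → signedTriple y z ≡ just g → ∃[ s ] (g ≡ (s , y , z) × Signed s (y , z))
  signedTriple⁻ {y} {z} eq with (y , z) ∈ᵘ? A | (y , z) ∈ᵘ? B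
  signedTriple⁻ refl | yes yz∈A | _        = false , refl , yz∈A
  signedTriple⁻ refl | no _     | yes yz∈B = true , refl , yz∈B

  signedTriple⁺ : ∀ {s y z} → Signed s (y , z) → signedTriple y z ≡ just (s , y , z)
  signedTriple⁺ {s} {y} {z} yz with (y , z) ∈ᵘ? A | (y , z) ∈ᵘ? B
  signedTriple⁺ {false} _    | yes _    | _     = refl
  signedTriple⁺ {false} yz∈A | no yz∉A  | _     = contradiction yz∈A yz∉A
  signedTriple⁺ {true}  yz∈B | yes yz∈A | _     = contradiction yz∈B (∈ᵘA⇒∉ᵘB yz∈A)
  signedTriple⁺ {true}  _    | no _     | yes _ = refl
  signedTriple⁺ {true}  yz∈B | no _     | no yz∉B = contradiction yz∈B yz∉B

  private
    oriented : Orientation _≟ₙ_ ∈ᵘ-swap deg (allNodes T)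
    oriented = orientation _≟ₙ_ ∈ᵘ-swap deg (allNodes T)

  out : Node T → List (Node T)
  out = proj₁ oriented

  length-out : ∀ y → length (out y) ≤ d
  length-out = proj₁ (proj₂ oriented)

  out-covers : ∀ {y z} → ABAdj y z → z ∈ out y ⊎ y ∈ out z
  out-covers = proj₂ (proj₂ oriented) (∈-allNodes _) (∈-allNodes _)

  signedOut : Node T → List (Bool × Node T × Node T)
  signedOut y = mapMaybe (signedTriple y) (out y)

  nodeLabel : Node T → Label (Node T)
  nodeLabel x = ancestors x , concatMap signedOut (ancestors x)

  ∈-signedPairs⁻ : ∀ {x s y z} → (s , y , z) ∈ proj₂ (nodeLabel x) → y ≼ x × Signed s (y , z)
  ∈-signedPairs⁻ {x} t∈ with find (∈-concatMap⁻ signedOut {xs = ancestors x} t∈)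
  ... | y′ , y′∈ , t∈′ with ∈-mapMaybe⁻ (signedTriple y′) (out y′) t∈′
  ...   | z′ , _ , eq with signedTriple⁻ eq
  ...     | s , refl , yz = ∈-ancestors⁻ y′∈ , yz

  ∈-signedPairs⁺ : ∀ {x s y z} → y ≼ x → z ∈ out y → Signed s (y , z) → (s , y , z) ∈ proj₂ (nodeLabel x)
  ∈-signedPairs⁺ y≼x z∈ yz =
    ∈-concatMap⁺ signedOut (lose (∈-ancestors⁺ y≼x) (∈-mapMaybe⁺ (signedTriple _) z∈ (signedTriple⁺ yz)))

  relevantAt : Node T → Node T → List (Bool × ℕ × ℕ)
  relevantAt xu xv = relevant _≟ₙ_ (nodeLabel xu) (nodeLabel xv)

  Located : Node T → Node T → Bool × ℕ × ℕ → Set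
  Located xu xv (s , i , j) = ∃₂ λ y z → y ≼ xu × z ≼ xv × Signed s (y , z) × level y ≡ i × level z ≡ j

  ∈-relevantAt⁻ : ∀ xu xv {g} → g ∈ relevantAt xu xv → Located xu xv g
  ∈-relevantAt⁻ xu xv g∈ with ∈-++⁻ (mapMaybe (locate _≟ₙ_ (ancestors xu) (ancestors xv)) (proj₂ (nodeLabel xu))) g∈
  ... | inj₁ g∈ˡ with ∈-mapMaybe⁻ (locate _≟ₙ_ (ancestors xu) (ancestors xv)) (proj₂ (nodeLabel xu)) g∈ˡ
  ...   | (s , y , z) , t∈ , loc with locate⁻ _≟ₙ_ (ancestors xu) (ancestors xv) loc
  ...     | i , j , y↦i , z↦j , refl =
    let y≼xu , yi = indexOf-ancestors⁻ y↦i ; z≼xv , zj = indexOf-ancestors⁻ z↦j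
    in y , z , y≼xu , z≼xv , proj₂ (∈-signedPairs⁻ {xu} t∈) , yi , zj
  ∈-relevantAt⁻ xu xv g∈ | inj₂ g∈ʳ with ∈-mapMaybe⁻ (locate _≟ₙ_ (ancestors xu) (ancestors xv) ∘ map₂ Product.swap) (proj₂ (nodeLabel xv)) g∈ʳ
  ...   | (s , z , y) , t∈ , loc with locate⁻ _≟ₙ_ (ancestors xu) (ancestors xv) loc
  ...     | i , j , y↦i , z↦j , refl =
    let y≼xu , yi = indexOf-ancestors⁻ y↦i ; z≼xv , zj = indexOf-ancestors⁻ z↦j
    in y , z , y≼xu , z≼xv , Signed-resp (inj₂ (refl , refl)) (proj₂ (∈-signedPairs⁻ {xv} t∈)) , yi , zj

  ∈-relevantAt⁺ : ∀ {xu xv s y z} → y ≼ xu → z ≼ xv → Signed s (y , z) → (s , level y , level z) ∈ relevantAt xu xv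
  ∈-relevantAt⁺ {xu} {xv} {s} {y} {z} y≼xu z≼xv yz = [ storedAtU , storedAtV ]′ (out-covers (Signed⇒ABAdj yz))
    where
    loc = locate _≟ₙ_ (ancestors xu) (ancestors xv)
    located : loc (s , y , z) ≡ just (s , level y , level z)
    located = locate-just _≟ₙ_ (ancestors xu) (ancestors xv) (indexOf-ancestors y≼xu) (indexOf-ancestors z≼xv)
    storedAtU : z ∈ out y → (s , level y , level z) ∈ relevantAt xu xv
    storedAtU z∈out = ∈-++⁺ˡ (∈-mapMaybe⁺ loc (∈-signedPairs⁺ {xu} y≼xu z∈out yz) located)
    storedAtV : y ∈ out z → (s , level y , level z) ∈ relevantAt xu xv
    storedAtV y∈out = ∈-++⁺ʳ _ (∈-mapMaybe⁺ (loc ∘ map₂ Product.swap)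
                        (∈-signedPairs⁺ {xv} z≼xv y∈out (Signed-resp (inj₂ (refl , refl)) yz)) located)

  modelAdj⇒adjacent : ∀ {u v} → ModelAdj u v → Adjacent (relevantAt (leaf u) (leaf v))
  modelAdj⇒adjacent {u} {v} (p , p∈B , p⪯uv , unshadowed) with ⪯-oriented p p⪯uv
  ... | y , z , p≈yz , y≼u , z≼v =
    lose (∈-relevantAt⁺ y≼u z≼v (p , p∈B , SamePair-sym p≈yz)) (refl , All.tabulate unblocked)
    where
    yz-transversal : Transversal (y , z)
    yz-transversal = Transversal-resp p≈yz (B-transversal p p∈B)
    unblocked : ∀ {g} → g ∈ relevantAt (leaf u) (leaf v) → ¬ Blocks (true , level y , level z) g
    unblocked {_ , _ , _} g∈ (refl , y≤ , z≤ , ¬same) with ∈-relevantAt⁻ _ _ g∈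
    ... | y′ , z′ , y′≼u , z′≼v , (q , q∈A , y′z′≈q) , refl , refl =
      unshadowed (q , q∈A , (p⪯q , p≉q) , ⪯-respˡ y′z′≈q (inj₁ (y′≼u , z′≼v)))
      where
      y≼y′ = level≤⇒≼ y≼u y′≼u y≤
      p⪯q : p ⪯ q
      p⪯q = ⪯-respˡ (SamePair-sym p≈yz) (⪯-respʳ y′z′≈q (inj₁ (y≼y′ , level≤⇒≼ z≼v z′≼v z≤)))
      p≉q : ¬ SamePair p q
      p≉q p≈q with SamePair-trans (SamePair-trans (SamePair-sym p≈yz) p≈q) (SamePair-sym y′z′≈q)
      ... | inj₁ (refl , refl) = ¬same (refl , refl)
      ... | inj₂ (refl , refl) = proj₁ yz-transversal y≼y′

  adjacent⇒modelAdj : ∀ {u v} → Adjacent (relevantAt (leaf u) (leaf v)) → ModelAdj u v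
  adjacent⇒modelAdj {u} {v} adj with find adj
  ... | (_ , _ , _) , g∈ , refl , unblocked with ∈-relevantAt⁻ _ _ g∈
  ... | y , z , y≼u , z≼v , (p , p∈B , yz≈p) , refl , refl =
    p , p∈B , ⪯-respˡ yz≈p (inj₁ (y≼u , z≼v)) , unshadowed
    where
    yz-transversal : Transversal (y , z)
    yz-transversal = Transversal-resp (SamePair-sym yz≈p) (B-transversal p p∈B)
    unshadowed : ¬ (∃[ q ] (q ∈ A × p ⪯≠ q × q ⪯ (leaf u , leaf v)))
    unshadowed (q , q∈A , (p⪯q , p≉q) , q⪯uv) with ⪯-oriented q q⪯uv
    ... | y′ , z′ , q≈y′z′ , y′≼u , z′≼v =
      All.lookup unblocked (∈-relevantAt⁺ y′≼u z′≼v (q , q∈A , SamePair-sym q≈y′z′))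
        (refl , ≼⇒level≤ y≼y′ , ≼⇒level≤ z≼z′ , ¬same)
      where
      y≼y′×z≼z′ = ⪯-componentwise yz-transversal y≼u y′≼u (⪯-respʳ q≈y′z′ (⪯-respˡ (SamePair-sym yz≈p) p⪯q))
      y≼y′ = proj₁ y≼y′×z≼z′
      z≼z′ = proj₂ y≼y′×z≼z′
      ¬same : ¬ (level y ≡ level y′ × level z ≡ level z′)
      ¬same (y≡ , z≡) = p≉q (SamePair-trans (SamePair-sym yz≈p)
        (SamePair-trans (inj₁ (level≡⇒≡ y≼u y′≼u y≡ , level≡⇒≡ z≼v z′≼v z≡)) (SamePair-sym q≈y′z′)))

  leafIndex : (z : Node T) → IsLeaf z → Fin n
  leafIndex z z-leaf = proj₁ (leaf-onto z z-leaf)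

  leafIndex-injective : ∀ {z z′} (p : IsLeaf z) (p′ : IsLeaf z′) → leafIndex z p ≡ leafIndex z′ p′ → z ≡ z′
  leafIndex-injective p p′ eq = trans (sym (proj₂ (leaf-onto _ p))) (trans (cong leaf eq) (proj₂ (leaf-onto _ p′)))

  leafBits : (z : Node T) → IsLeaf z → List Bool
  leafBits z z-leaf = binary (leafIndex z z-leaf)

  leafBits-injective : ∀ {z z′} (p : IsLeaf z) (p′ : IsLeaf z′) → leafBits z p ≡ leafBits z′ p′ → z ≡ z′
  leafBits-injective p p′ eq = leafIndex-injective p p′ (binary-injective eq)

  codeFields : Node T → List (List Bool)
  codeFields x = leafBits (leftmostLeaf x) (leftmostLeaf-isLeaf x) ∷ leafBits (leftmostRightLeaf x) (leftmostRightLeaf-isLeaf x) ∷ []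

  code : Node T → List Bool
  code x = encode (codeFields x)

  code-injective : Injective _≡_ _≡_ code
  code-injective {x} {y} eq = leafPair-injective
    (leafBits-injective (leftmostLeaf-isLeaf x) (leftmostLeaf-isLeaf y) (proj₁ fields≡))
    (leafBits-injective (leftmostRightLeaf-isLeaf x) (leftmostRightLeaf-isLeaf y) (proj₁ (∷-injective (proj₂ fields≡))))
    where
    fields≡ = ∷-injective (encode-injective {codeFields x} {codeFields y} eq)

  length-code : ∀ x → length (code x) ≤ codeLength ⌈log₂ n ⌉
  length-code x = length-encode-≤ (codeFields x)
    (≤-reflexive (length-binary (leafIndex _ (leftmostLeaf-isLeaf x))) ∷
     ≤-reflexive (length-binary (leafIndex _ (leftmostRightLeaf-isLeaf x))) ∷ [])

  label : Fin n → List Bool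
  label v = serialize (mapLabel code (nodeLabel (leaf v)))

  decoder-label : ∀ u v → decoder (label u) (label v) ≡ does (adjacent? (relevantAt (leaf u) (leaf v)))
  decoder-label u v = cong (does ∘ adjacent?) (begin
    relevant _≟ᵇ_ (parse (label u)) (parse (label v))
      ≡⟨ cong₂ (relevant _≟ᵇ_) (parse-serialize (codedLabel u)) (parse-serialize (codedLabel v)) ⟩
    relevant _≟ᵇ_ (codedLabel u) (codedLabel v)
      ≡⟨ relevant-mapLabel _≟ₙ_ _≟ᵇ_ code-injective (nodeLabel (leaf u)) (nodeLabel (leaf v)) ⟩
    relevantAt (leaf u) (leaf v) ∎)
    where
    open ≡-Reasoning
    _≟ᵇ_ = ≡-dec Bool._≟_
    codedLabel = λ w → mapLabel code (nodeLabel (leaf w))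

  length-label : ∀ {h} → depth T ≡ h → ∀ v →
                 length (label v) ≤ (h + h * d) * recordCost (codeLength ⌈log₂ n ⌉)
  length-label {h} depth≡h v = ≤-trans (length-serialize-≤ code length-code (ancestors x) (proj₂ (nodeLabel x)))
    (*-monoˡ-≤ _ (+-mono-≤ |ancestors|≤h (≤-trans (length-concatMap-≤ signedOut length-signedOut (ancestors x)) (*-monoˡ-≤ d |ancestors|≤h))))
    where
    x = leaf v
    |ancestors|≤h : length (ancestors x) ≤ h
    |ancestors|≤h = subst₂ _≤_ (sym (length-ancestors x)) depth≡h (level<depth x)
    length-signedOut : ∀ y → length (signedOut y) ≤ d
    length-signedOut y = ≤-trans (length-mapMaybe (signedTriple y) (out y)) (length-out y)

  decoder-correct : ∀ u v → ModelAdj u v ⇔ (decoder (label u) (label v) ≡ true)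
  decoder-correct u v = mk⇔
    (λ uv → trans (decoder-label u v) (dec-true (adjacent? _) (modelAdj⇒adjacent uv)))
    (λ uv → adjacent⇒modelAdj (dec-true⁻ (adjacent? _) (trans (sym (decoder-label u v)) uv)))

label-bound : ∀ {d h L} → 1 ≤ d → 1 ≤ L → (h + h * d) * recordCost (codeLength L) ≤ 182 * d * h * L
label-bound {d} {h} {L} 1≤d 1≤L = begin
  (h + h * d) * recordCost (codeLength L)
    ≡⟨ cong ((h + h * d) *_) (recordCost≡ L) ⟩
  (h + h * d) * (43 + 48 * L)   ≤⟨ *-mono-≤ (+-monoˡ-≤ (h * d) h≤hd) (+-monoˡ-≤ (48 * L) (*-monoʳ-≤ 43 1≤L)) ⟩
  (h * d + h * d) * (43 * L + 48 * L) ≡⟨ rearrange h d L ⟩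
  182 * d * h * L ∎
  where
  open ≤-Reasoning
  h≤hd : h ≤ h * d
  h≤hd = subst (_≤ h * d) (*-identityʳ h) (*-monoʳ-≤ h 1≤d)
  recordCost≡ : ∀ L → suc (2 * (3 * suc (2 * suc (2 * suc (2 * L))))) ≡ 43 + 48 * L
  recordCost≡ = solve-∀
  rearrange : ∀ h d L → (h * d + h * d) * (43 * L + 48 * L) ≡ 182 * d * h * L
  rearrange = solve-∀

proposition4p1 :
    Σ (List Bool → List Bool → Bool) λ D → Σ ℕ λ C →
      ((n d h : ℕ) → 2 ≤ n → 1 ≤ d → 1 ≤ h →
       (G : SimpleGraph n) (M : SignedTreeModel n) →
       HasModel G M →
       SignedTreeModel.width-is M d →
       depth (SignedTreeModel.T M) ≡ h →
       Σ (Fin n → List Bool) λ ℓ → ((∀ v → length (ℓ v) ≤ C * d * h * ⌈log₂ n ⌉) ×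
               (∀ u v → u ≢ v →
                  (SimpleGraph.Adj G u v ⇔ (D (ℓ u) (ℓ v) ≡ true)))))
proposition4p1 = decoder , 182 , λ n d h 2≤n 1≤d _ G M G-has-M width depth≡h →
  let open SignedModel M (proj₁ width) in
  label ,
  (λ v → ≤-trans (length-label depth≡h v) (label-bound 1≤d (⌈log₂⌉-mono-≤ 2≤n))) ,
  (λ u v _ → ⇔-trans (uncurry mk⇔ (G-has-M u v)) (decoder-correct u v))
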